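{- Let $N$ be a positive integer with base-$\varphi$ representation $N=\sum_{k=R}^{L} d_k\varphi^k$, where $\varphi=\frac{1+\sqrt5}{2}$, $R\le 0\le L$ are integers, each $d_k\in\{0,1\}$, and $d_kd_{k+1}=0$ for all $k$. Suppose there is a positive index $j$ with $d_j=1$, and let $i$ be the smallest positive index with $d_i=1$ (so $d_j=0$ for $0<j<i$). Then \[N = d_L L_L + d_{L-1}L_{L-1}+\dots+d_1L_1+d_0+1 \quad\text{if } i \text{ is odd},\] \[N = d_L L_L + d_{L-1}L_{L-1}+\dots+d_1L_1+d_0 \quad\text{if } i \text{ is even},\] where $L_n$ denotes the $n$-th Lucas number.
   Context: The Lucas numbers are defined by $L_0=2$, $L_1=1$, $L_n=L_{n-1}+L_{n-2}$. A base-$\varphi$ representation of $N$ is an expression $N=\sum_{k=R}^{L}d_k\varphi^k$ with digits $d_k\in\{0,1\}$, no two consecutive digits equal to $1$, and $R\le 0\le L$; every positive integer has a unique such representation (up to leading/trailing zeros). -}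

module Defs where

open import Data.Nat as ℕ using (ℕ; zero; suc)
open import Data.Integer as ℤ using (ℤ; +_; -[1+_]; ∣_∣)
open import Data.Product using (_×_; _,_)
open import Data.List using (List; map; upTo; foldr)

lucas : ℕ → ℕ
lucas zero = 2
lucas (suc zero) = 1
lucas (suc (suc n)) = lucas (suc n) ℕ.+ lucas n

-- The ring ℤ[φ] ⊂ ℝ, φ = (1+√5)/2: the pair (a , b) denotes a + b·φ.
-- Since 1, φ are ℚ-linearly independent, equality of pairs is equality of reals.
Zφ : Set
Zφ = ℤ × ℤ

_⊕_ : Zφ → Zφ → Zφ
(a , b) ⊕ (c , d) = (a ℤ.+ c , b ℤ.+ d)

_⊙_ : ℕ → Zφ → Zφ
n ⊙ (a , b) = ((+ n) ℤ.* a , (+ n) ℤ.* b)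

zeroφ : Zφ
zeroφ = (+ 0 , + 0)

ι : ℕ → Zφ
ι n = (+ n , + 0)

-- multiplication by φ (using φ² = φ + 1): φ(a + bφ) = b + (a+b)φ
mulφ : Zφ → Zφ
mulφ (a , b) = (b , a ℤ.+ b)

-- multiplication by φ⁻¹ = φ - 1: φ⁻¹(a + bφ) = (b - a) + aφ
divφ : Zφ → Zφ
divφ (a , b) = (b ℤ.- a , a)

iter : (Zφ → Zφ) → ℕ → Zφ → Zφ
iter f zero x = x
iter f (suc n) x = f (iter f n x)

φ^ : ℤ → Zφ
φ^ (+ n) = iter mulφ n (ι 1)
φ^ (-[1+ n ]) = iter divφ (suc n) (ι 1)

-- the list of integers R, R+1, …, L  (assuming R ≤ L)
range : ℤ → ℤ → List ℤ
range R L = map (λ t → R ℤ.+ (+ t)) (upTo (suc ∣ L ℤ.- R ∣))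

baseφValue : (ℤ → ℕ) → ℤ → ℤ → Zφ
baseφValue d R L = foldr (λ k acc → (d k ⊙ φ^ k) ⊕ acc) zeroφ (range R L)

lucasSum : (ℤ → ℕ) → ℕ → ℕ
lucasSum d zero = 0
lucasSum d (suc m) = d (+ suc m) ℕ.* lucas (suc m) ℕ.+ lucasSum d m

module Submission where

-- Write ψ = -φ⁻¹, so that Lₖ = φᵏ + ψᵏ. Replacing every φᵏ with k > 0 by Lₖ - ψᵏ turns the representation
-- into N + E = X + A + O, where X = Σₖ dₖLₖ + d₀ is the claimed value, A = Σ_{k<0} dₖφᵏ, and E and O
-- are the sums of dₖφ⁻ᵏ over the even and the odd k > 0. Non-adjacent 0/1 digits after the point sum
-- to less than 1, and to less than φ⁻ⁱ if they vanish up to position i. The first positive digit i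
-- contributes to O if i is odd and to E if i is even, so E < O, resp. O < E, and comparing integer
-- parts gives N = X + 1, resp. N = X.

open import Defs hiding (_⊕_; _⊙_)
open Defs using () renaming (_⊕_ to infixl 6 _⊕_; _⊙_ to infixr 7 _⊙_)
open import Algebra.Bundles using (CommutativeMonoid)
import Algebra.Solver.CommutativeMonoid as CommutativeMonoidSolver
open import Data.Empty using (⊥-elim)
open import Data.Integer as ℤ using (ℤ; +_; -[1+_]; ∣_∣)
import Data.Integer.Properties as ℤ
open import Algebra.Properties.AbelianGroup ℤ.+-0-abelianGroup using (∙-cancelʳ; //-rightDividesˡ)
open import Algebra.Properties.CommutativeSemigroup ℤ.+-commutativeSemigroup using (interchange)
open import Data.List using (List; []; _∷_; _++_; foldr; map; upTo; applyUpTo)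
open import Data.List.Properties using (map-++; map-cong; map-applyUpTo; map-upTo; applyUpTo-∷ʳ)
open import Data.Nat
  using (ℕ; zero; suc; z≤n; s≤s; _<_; _≤_; _≤′_; ≤′-reflexive; ≤′-step; _%_; _+_; _*_; parity)
import Data.Nat.Properties as ℕ
open import Data.Parity using (Parity; 0ℙ; 1ℙ; _⁻¹)
open import Data.Parity.Properties using (_≟_; p≢p⁻¹; ⁻¹-involutive)
open import Data.Product using (_×_; _,_; proj₁; proj₂; ∃-syntax)
open import Data.Sum using (_⊎_; inj₁; inj₂)
open import Function using (_∘_)
open import Relation.Binary.PropositionalEquality
  using (_≡_; refl; sym; trans; cong; cong₂; subst; subst₂; isEquivalence; module ≡-Reasoning)
open import Relation.Nullary using (yes; no; contradiction)

⊕-assoc : ∀ x y z → x ⊕ y ⊕ z ≡ x ⊕ (y ⊕ z)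
⊕-assoc (a , b) (c , d) (e , f) = cong₂ _,_ (ℤ.+-assoc a c e) (ℤ.+-assoc b d f)

⊕-comm : ∀ x y → x ⊕ y ≡ y ⊕ x
⊕-comm (a , b) (c , d) = cong₂ _,_ (ℤ.+-comm a c) (ℤ.+-comm b d)

⊕-identityˡ : ∀ x → zeroφ ⊕ x ≡ x
⊕-identityˡ (a , b) = cong₂ _,_ (ℤ.+-identityˡ a) (ℤ.+-identityˡ b)

⊕-identityʳ : ∀ x → x ⊕ zeroφ ≡ x
⊕-identityʳ (a , b) = cong₂ _,_ (ℤ.+-identityʳ a) (ℤ.+-identityʳ b)

⊕-cancelʳ : ∀ z x y → x ⊕ z ≡ y ⊕ z → x ≡ y
⊕-cancelʳ (e , f) (a , b) (c , d) eq =
  cong₂ _,_ (∙-cancelʳ e a c (cong proj₁ eq)) (∙-cancelʳ f b d (cong proj₂ eq))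

⊕-commutativeMonoid : CommutativeMonoid _ _
⊕-commutativeMonoid = record
  { Carrier = Zφ ; _≈_ = _≡_ ; _∙_ = _⊕_ ; ε = zeroφ
  ; isCommutativeMonoid = record
    { isMonoid = record
      { isSemigroup = record
        { isMagma = record { isEquivalence = isEquivalence ; ∙-cong = cong₂ _⊕_ }
        ; assoc = ⊕-assoc }
      ; identity = ⊕-identityˡ , ⊕-identityʳ }
    ; comm = ⊕-comm } }

open CommutativeMonoidSolver ⊕-commutativeMonoid using (solve; _⊜_) renaming (_⊕_ to infixl 6 _⊞_)

⊙-identityˡ : ∀ z → 1 ⊙ z ≡ z
⊙-identityˡ (a , b) = cong₂ _,_ (ℤ.*-identityˡ a) (ℤ.*-identityˡ b)

⊙-distribˡ-⊕ : ∀ c x y → c ⊙ (x ⊕ y) ≡ c ⊙ x ⊕ c ⊙ y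
⊙-distribˡ-⊕ c (a , b) (a′ , b′) = cong₂ _,_ (ℤ.*-distribˡ-+ (+ c) a a′) (ℤ.*-distribˡ-+ (+ c) b b′)

⊙-ι : ∀ c n → c ⊙ ι n ≡ ι (c * n)
⊙-ι c n = cong₂ _,_ (sym (ℤ.pos-* c n)) (ℤ.*-zeroʳ (+ c))

ι≡⊙ι1 : ∀ c → ι c ≡ c ⊙ ι 1
ι≡⊙ι1 c = sym (trans (⊙-ι c 1) (cong ι (ℕ.*-identityʳ c)))

mulφ-⊕ : ∀ x y → mulφ (x ⊕ y) ≡ mulφ x ⊕ mulφ y
mulφ-⊕ (a , b) (c , d) = cong (b ℤ.+ d ,_) (interchange a c b d)

mulφ-⊙ : ∀ c z → mulφ (c ⊙ z) ≡ c ⊙ mulφ z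
mulφ-⊙ c (a , b) = cong (+ c ℤ.* b ,_) (sym (ℤ.*-distribˡ-+ (+ c) a b))

mulφ-divφ : ∀ z → mulφ (divφ z) ≡ z
mulφ-divφ (a , b) = cong (a ,_) (//-rightDividesˡ a b)

iter-+ : ∀ f m n z → iter f (m + n) z ≡ iter f m (iter f n z)
iter-+ f zero    n z = refl
iter-+ f (suc m) n z = cong f (iter-+ f m n z)

iter-sucʳ : ∀ f n z → iter f (suc n) z ≡ iter f n (f z)
iter-sucʳ f zero    z = refl
iter-sucʳ f (suc n) z = cong f (iter-sucʳ f n z)

iter-mulφ-⊕ : ∀ n x y → iter mulφ n (x ⊕ y) ≡ iter mulφ n x ⊕ iter mulφ n y
iter-mulφ-⊕ zero    x y = refl
iter-mulφ-⊕ (suc n) x y = trans (cong mulφ (iter-mulφ-⊕ n x y)) (mulφ-⊕ (iter mulφ n x) (iter mulφ n y))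

iter-mulφ-⊙ : ∀ n c z → iter mulφ n (c ⊙ z) ≡ c ⊙ iter mulφ n z
iter-mulφ-⊙ zero    c z = refl
iter-mulφ-⊙ (suc n) c z = trans (cong mulφ (iter-mulφ-⊙ n c z)) (mulφ-⊙ c (iter mulφ n z))

φ^⁺ φ^⁻ : ℕ → Zφ
φ^⁺ n = iter mulφ n (ι 1)
φ^⁻ n = iter divφ n (ι 1)

iter-mulφ-ι : ∀ n c → iter mulφ n (ι c) ≡ c ⊙ φ^⁺ n
iter-mulφ-ι n c = trans (cong (iter mulφ n) (ι≡⊙ι1 c)) (iter-mulφ-⊙ n c (ι 1))

iter-mulφ-φ^⁻ : ∀ n → iter mulφ n (φ^⁻ n) ≡ ι 1
iter-mulφ-φ^⁻ zero    = refl
iter-mulφ-φ^⁻ (suc n) =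
  trans (iter-sucʳ mulφ n (φ^⁻ (suc n)))
        (trans (cong (iter mulφ n) (mulφ-divφ (φ^⁻ n))) (iter-mulφ-φ^⁻ n))

φ^⁻-rec : ∀ k → φ^⁻ k ≡ φ^⁻ (suc k) ⊕ φ^⁻ (suc (suc k))
φ^⁻-rec k = begin
  φ^⁻ k                    ≡⟨ sym (mulφ-divφ (φ^⁻ k)) ⟩
  mulφ (φ^⁻ (suc k))       ≡⟨ cong mulφ (sym (mulφ-divφ (φ^⁻ (suc k)))) ⟩
  mulφ (mulφ y)            ≡⟨⟩
  y ⊕ mulφ y               ≡⟨ ⊕-comm y (mulφ y) ⟩
  mulφ y ⊕ y               ≡⟨ cong (_⊕ y) (mulφ-divφ (φ^⁻ (suc k))) ⟩
  φ^⁻ (suc k) ⊕ y          ∎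
  where
  open ≡-Reasoning
  y : Zφ
  y = φ^⁻ (suc (suc k))

parity-suc : ∀ n → parity (suc n) ≡ parity n ⁻¹
parity-suc zero          = refl
parity-suc (suc zero)    = refl
parity-suc (suc (suc n)) = parity-suc n

-- Lₖ = φᵏ + ψᵏ with ψ = -φ⁻¹, split according to the sign of ψᵏ.
mutual
  lucas-even : ∀ k → parity k ≡ 0ℙ → φ^⁺ k ⊕ φ^⁻ k ≡ ι (lucas k)
  lucas-even zero          _ = refl
  lucas-even (suc (suc k)) e = ⊕-cancelʳ (φ^⁻ (suc k)) _ _ (begin
    φ^⁺ k ⊕ φ^⁺ (suc k) ⊕ φ^⁻ (suc (suc k)) ⊕ φ^⁻ (suc k)
      ≡⟨ solve 4 (λ a b c d → a ⊞ b ⊞ c ⊞ d ⊜ b ⊞ (a ⊞ (d ⊞ c))) refl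
           (φ^⁺ k) (φ^⁺ (suc k)) (φ^⁻ (suc (suc k))) (φ^⁻ (suc k)) ⟩
    φ^⁺ (suc k) ⊕ (φ^⁺ k ⊕ (φ^⁻ (suc k) ⊕ φ^⁻ (suc (suc k))))
      ≡⟨ cong (λ x → φ^⁺ (suc k) ⊕ (φ^⁺ k ⊕ x)) (sym (φ^⁻-rec k)) ⟩
    φ^⁺ (suc k) ⊕ (φ^⁺ k ⊕ φ^⁻ k)
      ≡⟨ cong₂ _⊕_ (lucas-odd (suc k) (trans (parity-suc k) (cong _⁻¹ e))) (lucas-even k e) ⟩
    ι (lucas (suc k)) ⊕ φ^⁻ (suc k) ⊕ ι (lucas k)
      ≡⟨ solve 3 (λ a b c → a ⊞ b ⊞ c ⊜ a ⊞ c ⊞ b) refl (ι (lucas (suc k))) (φ^⁻ (suc k)) (ι (lucas k)) ⟩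
    ι (lucas (suc (suc k))) ⊕ φ^⁻ (suc k) ∎)
    where open ≡-Reasoning

  lucas-odd : ∀ k → parity k ≡ 1ℙ → φ^⁺ k ≡ ι (lucas k) ⊕ φ^⁻ k
  lucas-odd (suc zero)    _ = refl
  lucas-odd (suc (suc k)) e = ⊕-cancelʳ (φ^⁻ (suc k)) _ _ (begin
    φ^⁺ k ⊕ φ^⁺ (suc k) ⊕ φ^⁻ (suc k)
      ≡⟨ ⊕-assoc (φ^⁺ k) (φ^⁺ (suc k)) (φ^⁻ (suc k)) ⟩
    φ^⁺ k ⊕ (φ^⁺ (suc k) ⊕ φ^⁻ (suc k))
      ≡⟨ cong₂ _⊕_ (lucas-odd k e) (lucas-even (suc k) (trans (parity-suc k) (cong _⁻¹ e))) ⟩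
    ι (lucas k) ⊕ φ^⁻ k ⊕ ι (lucas (suc k))
      ≡⟨ cong (λ x → ι (lucas k) ⊕ x ⊕ ι (lucas (suc k))) (φ^⁻-rec k) ⟩
    ι (lucas k) ⊕ (φ^⁻ (suc k) ⊕ φ^⁻ (suc (suc k))) ⊕ ι (lucas (suc k))
      ≡⟨ solve 4 (λ a b c d → a ⊞ (b ⊞ c) ⊞ d ⊜ d ⊞ a ⊞ c ⊞ b) refl
           (ι (lucas k)) (φ^⁻ (suc k)) (φ^⁻ (suc (suc k))) (ι (lucas (suc k))) ⟩
    ι (lucas (suc (suc k))) ⊕ φ^⁻ (suc (suc k)) ⊕ φ^⁻ (suc k) ∎)
    where open ≡-Reasoning

-- The order of ℤ[φ]

-- An element of ℤ[φ] is a positive real iff φⁿ times it has nonnegative coordinates for large n (its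
-- conjugate part decays); taking this as the definition gives the order without real numbers.

record NonnegCoords (z : Zφ) : Set where
  constructor nonnegCoords
  field
    fst≥0 : + 0 ℤ.≤ proj₁ z
    snd≥0 : + 0 ℤ.≤ proj₂ z

record PositiveCoords (z : Zφ) : Set where
  constructor positiveCoords
  field
    fst≥0 : + 0 ℤ.≤ proj₁ z
    snd>0 : + 0 ℤ.< proj₂ z

Eventually : (Zφ → Set) → Zφ → Set
Eventually P z = ∃[ n ] P (iter mulφ n z)

Nonneg Positive : Zφ → Set
Nonneg   = Eventually NonnegCoords
Positive = Eventually PositiveCoords

nonnegCoords-ι : ∀ n → NonnegCoords (ι n)
nonnegCoords-ι n = nonnegCoords (ℤ.+≤+ z≤n) (ℤ.+≤+ z≤n)

mulφ-nonnegCoords : ∀ z → NonnegCoords z → NonnegCoords (mulφ z)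
mulφ-nonnegCoords _ (nonnegCoords a≥0 b≥0) = nonnegCoords b≥0 (ℤ.+-mono-≤ a≥0 b≥0)

mulφ-positiveCoords : ∀ z → PositiveCoords z → PositiveCoords (mulφ z)
mulφ-positiveCoords _ (positiveCoords a≥0 b>0) = positiveCoords (ℤ.<⇒≤ b>0) (ℤ.+-mono-≤-< a≥0 b>0)

⊕-nonnegCoords : ∀ {x y} → NonnegCoords x → NonnegCoords y → NonnegCoords (x ⊕ y)
⊕-nonnegCoords (nonnegCoords a≥0 b≥0) (nonnegCoords c≥0 d≥0) =
  nonnegCoords (ℤ.+-mono-≤ a≥0 c≥0) (ℤ.+-mono-≤ b≥0 d≥0)

⊕-positiveCoords : ∀ {x y} → PositiveCoords x → NonnegCoords y → PositiveCoords (x ⊕ y)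
⊕-positiveCoords (positiveCoords a≥0 b>0) (nonnegCoords c≥0 d≥0) =
  positiveCoords (ℤ.+-mono-≤ a≥0 c≥0) (ℤ.+-mono-<-≤ b>0 d≥0)

⊙-nonnegCoords : ∀ c {z} → NonnegCoords z → NonnegCoords (c ⊙ z)
⊙-nonnegCoords c (nonnegCoords (ℤ.+≤+ {n = a} _) (ℤ.+≤+ {n = b} _)) =
  nonnegCoords (subst (+ 0 ℤ.≤_) (ℤ.pos-* c a) (ℤ.+≤+ z≤n))
               (subst (+ 0 ℤ.≤_) (ℤ.pos-* c b) (ℤ.+≤+ z≤n))

iter-stable : ∀ {P : Zφ → Set} → (∀ z → P z → P (mulφ z)) → ∀ n {z} → P z → P (iter mulφ n z)
iter-stable P-mulφ zero    p = p
iter-stable P-mulφ (suc n) {z} p = P-mulφ (iter mulφ n z) (iter-stable P-mulφ n p)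

eventually-⊕ : ∀ {P Q R : Zφ → Set} →
  (∀ z → P z → P (mulφ z)) → (∀ z → Q z → Q (mulφ z)) → (∀ {x y} → P x → Q y → R (x ⊕ y)) →
  ∀ {x y} → Eventually P x → Eventually Q y → Eventually R (x ⊕ y)
eventually-⊕ {P} {Q} {R} P-mulφ Q-mulφ PQ⇒R {x} {y} (m , p) (n , q) =
  n + m , subst R (sym (iter-mulφ-⊕ (n + m) x y)) (PQ⇒R p′ q′)
  where
  p′ : P (iter mulφ (n + m) x)
  p′ = subst P (sym (iter-+ mulφ n m x)) (iter-stable P-mulφ n {iter mulφ m x} p)
  q′ : Q (iter mulφ (n + m) y)
  q′ = subst (λ k → Q (iter mulφ k y)) (ℕ.+-comm m n)
         (subst Q (sym (iter-+ mulφ m n y)) (iter-stable Q-mulφ m {iter mulφ n y} q))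

nonneg-⊕ : ∀ {x y} → Nonneg x → Nonneg y → Nonneg (x ⊕ y)
nonneg-⊕ = eventually-⊕ {NonnegCoords} {NonnegCoords} {NonnegCoords}
  mulφ-nonnegCoords mulφ-nonnegCoords ⊕-nonnegCoords

positive-⊕ : ∀ {x y} → Positive x → Nonneg y → Positive (x ⊕ y)
positive-⊕ = eventually-⊕ {PositiveCoords} {NonnegCoords} {PositiveCoords}
  mulφ-positiveCoords mulφ-nonnegCoords ⊕-positiveCoords

nonneg-⊙ : ∀ c {z} → Nonneg z → Nonneg (c ⊙ z)
nonneg-⊙ c {z} (n , p) = n , subst NonnegCoords (sym (iter-mulφ-⊙ n c z)) (⊙-nonnegCoords c p)

positive⇒nonneg : ∀ {z} → Positive z → Nonneg z
positive⇒nonneg (n , positiveCoords a≥0 b>0) = n , nonnegCoords a≥0 (ℤ.<⇒≤ b>0)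

nonneg-zeroφ : Nonneg zeroφ
nonneg-zeroφ = 0 , nonnegCoords-ι 0

positive-φ^⁻ : ∀ k → Positive (φ^⁻ k)
positive-φ^⁻ k = suc k , subst PositiveCoords (cong mulφ (sym (iter-mulφ-φ^⁻ k)))
                               (positiveCoords (ℤ.+≤+ z≤n) (ℤ.+<+ (s≤s z≤n)))

nonneg-φ^⁻ : ∀ k → Nonneg (φ^⁻ k)
nonneg-φ^⁻ k = positive⇒nonneg (positive-φ^⁻ k)

infix 4 _≤φ_ _<φ_

record _≤φ_ (x y : Zφ) : Set where
  constructor ≤φ-by
  field
    gap        : Zφ
    gap-nonneg : Nonneg gap
    y≡x⊕gap    : y ≡ x ⊕ gap

record _<φ_ (x y : Zφ) : Set where
  constructor <φ-by
  field
    gap          : Zφ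
    gap-positive : Positive gap
    y≡x⊕gap      : y ≡ x ⊕ gap

≤φ-reflexive : ∀ {x y} → x ≡ y → x ≤φ y
≤φ-reflexive {x} refl = ≤φ-by zeroφ nonneg-zeroφ (sym (⊕-identityʳ x))

<⇒≤φ : ∀ {x y} → x <φ y → x ≤φ y
<⇒≤φ (<φ-by δ p eq) = ≤φ-by δ (positive⇒nonneg p) eq

≤φ-⊕ʳ : ∀ x {δ} → Nonneg δ → x ≤φ x ⊕ δ
≤φ-⊕ʳ x {δ} p = ≤φ-by δ p refl

≤φ-⊕ˡ : ∀ x {δ} → Nonneg δ → x ≤φ δ ⊕ x
≤φ-⊕ˡ x {δ} p = ≤φ-by δ p (⊕-comm δ x)

<φ-⊕ʳ : ∀ x {δ} → Positive δ → x <φ x ⊕ δ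
<φ-⊕ʳ x {δ} p = <φ-by δ p refl

≤φ-trans : ∀ {x y z} → x ≤φ y → y ≤φ z → x ≤φ z
≤φ-trans {x} (≤φ-by δ p refl) (≤φ-by ε q refl) = ≤φ-by (δ ⊕ ε) (nonneg-⊕ p q) (⊕-assoc x δ ε)

<φ-≤φ-trans : ∀ {x y z} → x <φ y → y ≤φ z → x <φ z
<φ-≤φ-trans {x} (<φ-by δ p refl) (≤φ-by ε q refl) = <φ-by (δ ⊕ ε) (positive-⊕ p q) (⊕-assoc x δ ε)

≤φ-<φ-trans : ∀ {x y z} → x ≤φ y → y <φ z → x <φ z
≤φ-<φ-trans {x} (≤φ-by δ p refl) (<φ-by ε q refl) =
  <φ-by (δ ⊕ ε) (subst Positive (⊕-comm ε δ) (positive-⊕ q p)) (⊕-assoc x δ ε)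

⊕-monoʳ-≤φ : ∀ z {x y} → x ≤φ y → z ⊕ x ≤φ z ⊕ y
⊕-monoʳ-≤φ z {x} (≤φ-by δ p refl) = ≤φ-by δ p (sym (⊕-assoc z x δ))

⊕-monoʳ-<φ : ∀ z {x y} → x <φ y → z ⊕ x <φ z ⊕ y
⊕-monoʳ-<φ z {x} (<φ-by δ p refl) = <φ-by δ p (sym (⊕-assoc z x δ))

⊕-mono-<φ-≤φ : ∀ {x y u v} → x <φ y → u ≤φ v → x ⊕ u <φ y ⊕ v
⊕-mono-<φ-≤φ {x} {u = u} (<φ-by δ p refl) (≤φ-by ε q refl) =
  <φ-by (δ ⊕ ε) (positive-⊕ p q)
        (solve 4 (λ x δ u ε → x ⊞ δ ⊞ (u ⊞ ε) ⊜ x ⊞ u ⊞ (δ ⊞ ε)) refl x δ u ε)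

⊕-cancelʳ-<φ : ∀ z {x y} → x ⊕ z <φ y ⊕ z → x <φ y
⊕-cancelʳ-<φ z {x} {y} (<φ-by δ p eq) =
  <φ-by δ p (⊕-cancelʳ z y (x ⊕ δ)
              (trans eq (solve 3 (λ x z δ → x ⊞ z ⊞ δ ⊜ x ⊞ δ ⊞ z) refl x z δ)))

-- Compare the second coordinates of φᵏ·ι n = φᵏ·ι m + φᵏ·δ, where φᵏ·δ has a positive second coordinate.
ι-<φ-reflect : ∀ {m n} → ι m <φ ι n → m < n
ι-<φ-reflect {m} {n} (<φ-by δ (k , positiveCoords _ q>0) eq) =
  ℤ.drop‿+<+ (ℤ.*-cancelʳ-<-nonNeg s {{ℤ.nonNegative s≥0}} ms<ns)
  where
  open ≡-Reasoning
  s : ℤ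
  s = proj₂ (φ^⁺ k)
  s≥0 : + 0 ℤ.≤ s
  s≥0 = NonnegCoords.snd≥0 (iter-stable {NonnegCoords} mulφ-nonnegCoords k (nonnegCoords-ι 1))
  scaled : n ⊙ φ^⁺ k ≡ m ⊙ φ^⁺ k ⊕ iter mulφ k δ
  scaled = begin
    n ⊙ φ^⁺ k                           ≡⟨ sym (iter-mulφ-ι k n) ⟩
    iter mulφ k (ι n)                   ≡⟨ cong (iter mulφ k) eq ⟩
    iter mulφ k (ι m ⊕ δ)               ≡⟨ iter-mulφ-⊕ k (ι m) δ ⟩
    iter mulφ k (ι m) ⊕ iter mulφ k δ   ≡⟨ cong (_⊕ iter mulφ k δ) (iter-mulφ-ι k m) ⟩
    m ⊙ φ^⁺ k ⊕ iter mulφ k δ           ∎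
  ms<ns : + m ℤ.* s ℤ.< + n ℤ.* s
  ms<ns = subst₂ ℤ._<_ (ℤ.+-identityʳ (+ m ℤ.* s)) (sym (cong proj₂ scaled))
            (ℤ.+-monoʳ-< (+ m ℤ.* s) q>0)

φ^⁻-suc-≤φ : ∀ k → φ^⁻ (suc k) ≤φ φ^⁻ k
φ^⁻-suc-≤φ k = ≤φ-by (φ^⁻ (suc (suc k))) (nonneg-φ^⁻ (suc (suc k))) (φ^⁻-rec k)

-- Digit sums

fracSum : (ℕ → ℕ) → ℕ → Zφ
fracSum f zero    = zeroφ
fracSum f (suc m) = f (suc m) ⊙ φ^⁻ (suc m) ⊕ fracSum f m

intSum : (ℕ → ℕ) → ℕ → Zφ
intSum g zero    = zeroφ
intSum g (suc m) = g (suc m) ⊙ φ^⁺ (suc m) ⊕ intSum g m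

fracSum-nonneg : ∀ f m → Nonneg (fracSum f m)
fracSum-nonneg f zero    = nonneg-zeroφ
fracSum-nonneg f (suc m) = nonneg-⊕ (nonneg-⊙ (f (suc m)) (nonneg-φ^⁻ (suc m))) (fracSum-nonneg f m)

-- 0 ⊙ z and zeroφ ⊕ zeroφ both reduce to zeroφ.
fracSum-vanish : ∀ f m → (∀ k → 1 ≤ k → k ≤ m → f k ≡ 0) → fracSum f m ≡ zeroφ
fracSum-vanish f zero    _   = refl
fracSum-vanish f (suc m) f≡0 = cong₂ (λ c s → c ⊙ φ^⁻ (suc m) ⊕ s)
  (f≡0 (suc m) (s≤s z≤n) ℕ.≤-refl)
  (fracSum-vanish f m (λ k 1≤k k≤m → f≡0 k 1≤k (ℕ.m≤n⇒m≤1+n k≤m)))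

φ^⁻-≤φ-fracSum : ∀ f {i m} → f i ≡ 1 → 1 ≤ i → i ≤ m → φ^⁻ i ≤φ fracSum f m
φ^⁻-≤φ-fracSum f {suc _} {zero} _ _ ()
φ^⁻-≤φ-fracSum f {i} {suc m} fi≡1 1≤i i≤1+m with ℕ.m≤n⇒m<n∨m≡n i≤1+m
... | inj₁ i<1+m = ≤φ-trans (φ^⁻-≤φ-fracSum f fi≡1 1≤i (ℕ.m<1+n⇒m≤n i<1+m))
                            (≤φ-⊕ˡ (fracSum f m) (nonneg-⊙ (f (suc m)) (nonneg-φ^⁻ (suc m))))
... | inj₂ refl = subst (_≤φ fracSum f (suc m)) (trans (cong (_⊙ φ^⁻ i) fi≡1) (⊙-identityˡ (φ^⁻ i)))
                        (≤φ-⊕ʳ (f i ⊙ φ^⁻ i) (fracSum-nonneg f m))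

≤1⇒≡0⊎≡1 : ∀ {c} → c ≤ 1 → c ≡ 0 ⊎ c ≡ 1
≤1⇒≡0⊎≡1 z≤n       = inj₁ refl
≤1⇒≡0⊎≡1 (s≤s z≤n) = inj₂ refl

-- The invariant: the sum up to n leaves room for φ⁻⁽ⁿ⁺¹⁾, and even for φ⁻ⁿ when digit n is 0.
fracSum-<φ : ∀ {f} → (∀ k → f k ≤ 1) → (∀ k → f k * f (suc k) ≡ 0) →
  ∀ {j m} → (∀ k → 1 ≤ k → k ≤ j → f k ≡ 0) → j ≤ m → fracSum f m <φ φ^⁻ j
fracSum-<φ {f} f≤1 f-nonadjacent {j} {m} f≡0 j≤m =
  <φ-≤φ-trans (<φ-⊕ʳ (fracSum f m) (positive-φ^⁻ (suc m))) (proj₁ (invariant (ℕ.≤⇒≤′ j≤m)))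
  where
  Invariant : ℕ → Set
  Invariant n = (fracSum f n ⊕ φ^⁻ (suc n) ≤φ φ^⁻ j) × (f n ≡ 0 → fracSum f n ⊕ φ^⁻ n ≤φ φ^⁻ j)

  start : Invariant j
  start = ≤φ-trans (≤φ-reflexive (drop (suc j))) (φ^⁻-suc-≤φ j) , λ _ → ≤φ-reflexive (drop j)
    where
    drop : ∀ k → fracSum f j ⊕ φ^⁻ k ≡ φ^⁻ k
    drop k = trans (cong (_⊕ φ^⁻ k) (fracSum-vanish f j f≡0)) (⊕-identityˡ (φ^⁻ k))

  step : ∀ {n} → Invariant n → Invariant (suc n)
  step {n} (room , room-if-0) with ≤1⇒≡0⊎≡1 (f≤1 (suc n))
  ... | inj₁ f[1+n]≡0 =
    ≤φ-trans (⊕-monoʳ-≤φ (fracSum f (suc n)) (φ^⁻-suc-≤φ (suc n))) room′ , λ _ → room′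
    where
    unchanged : fracSum f (suc n) ≡ fracSum f n
    unchanged = trans (cong (λ c → c ⊙ φ^⁻ (suc n) ⊕ fracSum f n) f[1+n]≡0) (⊕-identityˡ (fracSum f n))
    room′ : fracSum f (suc n) ⊕ φ^⁻ (suc n) ≤φ φ^⁻ j
    room′ = subst (λ s → s ⊕ φ^⁻ (suc n) ≤φ φ^⁻ j) (sym unchanged) room
  ... | inj₂ f[1+n]≡1 =
    ≤φ-trans (≤φ-reflexive absorb) (room-if-0 fn≡0) ,
    λ f[1+n]≡0 → ⊥-elim (ℕ.1+n≢0 (trans (sym f[1+n]≡1) f[1+n]≡0))
    where
    open ≡-Reasoning
    fn≡0 : f n ≡ 0
    fn≡0 = trans (sym (ℕ.*-identityʳ (f n))) (subst (λ c → f n * c ≡ 0) f[1+n]≡1 (f-nonadjacent n))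
    absorb : fracSum f (suc n) ⊕ φ^⁻ (suc (suc n)) ≡ fracSum f n ⊕ φ^⁻ n
    absorb = begin
      f (suc n) ⊙ φ^⁻ (suc n) ⊕ fracSum f n ⊕ φ^⁻ (suc (suc n))
        ≡⟨ cong (λ c → c ⊙ φ^⁻ (suc n) ⊕ fracSum f n ⊕ φ^⁻ (suc (suc n))) f[1+n]≡1 ⟩
      1 ⊙ φ^⁻ (suc n) ⊕ fracSum f n ⊕ φ^⁻ (suc (suc n))
        ≡⟨ cong (λ x → x ⊕ fracSum f n ⊕ φ^⁻ (suc (suc n))) (⊙-identityˡ (φ^⁻ (suc n))) ⟩
      φ^⁻ (suc n) ⊕ fracSum f n ⊕ φ^⁻ (suc (suc n))
        ≡⟨ solve 3 (λ a s b → a ⊞ s ⊞ b ⊜ s ⊞ (a ⊞ b)) refl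
             (φ^⁻ (suc n)) (fracSum f n) (φ^⁻ (suc (suc n))) ⟩
      fracSum f n ⊕ (φ^⁻ (suc n) ⊕ φ^⁻ (suc (suc n)))
        ≡⟨ cong (fracSum f n ⊕_) (sym (φ^⁻-rec n)) ⟩
      fracSum f n ⊕ φ^⁻ n ∎

  invariant : ∀ {n} → j ≤′ n → Invariant n
  invariant (≤′-reflexive refl) = start
  invariant (≤′-step j≤′n)      = step (invariant j≤′n)

fracSum-<φ-1 : ∀ {f} → (∀ k → f k ≤ 1) → (∀ k → f k * f (suc k) ≡ 0) → ∀ m → fracSum f m <φ ι 1
fracSum-<φ-1 f≤1 f-nonadjacent m = fracSum-<φ f≤1 f-nonadjacent (λ { zero () _ ; (suc _) _ () }) z≤n

-- Splitting digits by parity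

restrict : Parity → (ℕ → ℕ) → ℕ → ℕ
restrict p g k with parity k ≟ p
... | yes _ = g k
... | no  _ = 0

restrict-≤ : ∀ p g k → restrict p g k ≤ g k
restrict-≤ p g k with parity k ≟ p
... | yes _ = ℕ.≤-refl
... | no  _ = z≤n

restrict-self : ∀ p g k → parity k ≡ p → restrict p g k ≡ g k
restrict-self p g k e with parity k ≟ p
... | yes _  = refl
... | no  ≢p = contradiction e ≢p

restrict-other : ∀ p g k → parity k ≡ p ⁻¹ → restrict p g k ≡ 0
restrict-other p g k e with parity k ≟ p
... | yes e′ = contradiction (trans (sym e′) e) (p≢p⁻¹ p)
... | no  _  = refl

restrict-vanish : ∀ p g {k} → g k ≡ 0 → restrict p g k ≡ 0
restrict-vanish p g {k} gk≡0 = ℕ.n≤0⇒n≡0 (subst (restrict p g k ≤_) gk≡0 (restrict-≤ p g k))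

restrict-nonadjacent : ∀ p g k → restrict p g k * restrict p g (suc k) ≡ 0
restrict-nonadjacent p g k with parity k ≟ p
... | no  _ = refl
... | yes e = trans (cong (g k *_) (restrict-other p g (suc k) (trans (parity-suc k) (cong _⁻¹ e))))
                    (ℕ.*-zeroʳ (g k))

lucas-term : ∀ g k →
  g k ⊙ φ^⁺ k ⊕ restrict 0ℙ g k ⊙ φ^⁻ k ≡ ι (g k * lucas k) ⊕ restrict 1ℙ g k ⊙ φ^⁻ k
lucas-term g k = by-parity (parity k) refl
  where
  open ≡-Reasoning
  by-parity : ∀ p → parity k ≡ p →
    g k ⊙ φ^⁺ k ⊕ restrict 0ℙ g k ⊙ φ^⁻ k ≡ ι (g k * lucas k) ⊕ restrict 1ℙ g k ⊙ φ^⁻ k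
  by-parity 0ℙ e = begin
    g k ⊙ φ^⁺ k ⊕ restrict 0ℙ g k ⊙ φ^⁻ k  ≡⟨ cong (λ c → g k ⊙ φ^⁺ k ⊕ c ⊙ φ^⁻ k) (restrict-self 0ℙ g k e) ⟩
    g k ⊙ φ^⁺ k ⊕ g k ⊙ φ^⁻ k              ≡⟨ sym (⊙-distribˡ-⊕ (g k) (φ^⁺ k) (φ^⁻ k)) ⟩
    g k ⊙ (φ^⁺ k ⊕ φ^⁻ k)                  ≡⟨ cong (g k ⊙_) (lucas-even k e) ⟩
    g k ⊙ ι (lucas k)                      ≡⟨ ⊙-ι (g k) (lucas k) ⟩
    ι (g k * lucas k)                      ≡⟨ sym (⊕-identityʳ (ι (g k * lucas k))) ⟩
    ι (g k * lucas k) ⊕ 0 ⊙ φ^⁻ k          ≡⟨ cong (λ c → ι (g k * lucas k) ⊕ c ⊙ φ^⁻ k)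
                                                (sym (restrict-other 1ℙ g k e)) ⟩
    ι (g k * lucas k) ⊕ restrict 1ℙ g k ⊙ φ^⁻ k ∎
  by-parity 1ℙ e = begin
    g k ⊙ φ^⁺ k ⊕ restrict 0ℙ g k ⊙ φ^⁻ k  ≡⟨ cong (λ c → g k ⊙ φ^⁺ k ⊕ c ⊙ φ^⁻ k)
                                                (restrict-other 0ℙ g k e) ⟩
    g k ⊙ φ^⁺ k ⊕ 0 ⊙ φ^⁻ k                ≡⟨ ⊕-identityʳ (g k ⊙ φ^⁺ k) ⟩
    g k ⊙ φ^⁺ k                            ≡⟨ cong (g k ⊙_) (lucas-odd k e) ⟩
    g k ⊙ (ι (lucas k) ⊕ φ^⁻ k)            ≡⟨ ⊙-distribˡ-⊕ (g k) (ι (lucas k)) (φ^⁻ k) ⟩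
    g k ⊙ ι (lucas k) ⊕ g k ⊙ φ^⁻ k        ≡⟨ cong₂ _⊕_ (⊙-ι (g k) (lucas k))
                                                          (cong (_⊙ φ^⁻ k) (sym (restrict-self 1ℙ g k e))) ⟩
    ι (g k * lucas k) ⊕ restrict 1ℙ g k ⊙ φ^⁻ k ∎

intSum-lucas : ∀ d m →
  intSum (d ∘ +_) m ⊕ fracSum (restrict 0ℙ (d ∘ +_)) m ≡ ι (lucasSum d m) ⊕ fracSum (restrict 1ℙ (d ∘ +_)) m
intSum-lucas d zero    = refl
intSum-lucas d (suc m) = begin
  p ⊕ P ⊕ (e ⊕ E)                   ≡⟨ solve 4 (λ p P e E → p ⊞ P ⊞ (e ⊞ E) ⊜ p ⊞ e ⊞ (P ⊞ E)) refl p P e E ⟩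
  p ⊕ e ⊕ (P ⊕ E)                   ≡⟨ cong₂ _⊕_ (lucas-term (d ∘ +_) (suc m)) (intSum-lucas d m) ⟩
  ι l ⊕ o ⊕ (ι (lucasSum d m) ⊕ O)  ≡⟨ solve 4 (λ l o L O → l ⊞ o ⊞ (L ⊞ O) ⊜ l ⊞ L ⊞ (o ⊞ O)) refl
                                         (ι l) o (ι (lucasSum d m)) O ⟩
  ι (lucasSum d (suc m)) ⊕ (o ⊕ O)  ∎
  where
  open ≡-Reasoning
  g : ℕ → ℕ
  g = d ∘ +_
  p P e E o O : Zφ
  p = g (suc m) ⊙ φ^⁺ (suc m)
  P = intSum g m
  e = restrict 0ℙ g (suc m) ⊙ φ^⁻ (suc m)
  E = fracSum (restrict 0ℙ g) m
  o = restrict 1ℙ g (suc m) ⊙ φ^⁻ (suc m)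
  O = fracSum (restrict 1ℙ g) m
  l : ℕ
  l = g (suc m) * lucas (suc m)

-- The value of a base-φ representation

digitValue : (ℤ → ℕ) → List ℤ → Zφ
digitValue d = foldr (λ k acc → d k ⊙ φ^ k ⊕ acc) zeroφ

digitValue-++ : ∀ d ks ls → digitValue d (ks ++ ls) ≡ digitValue d ks ⊕ digitValue d ls
digitValue-++ d []       ls = sym (⊕-identityˡ (digitValue d ls))
digitValue-++ d (k ∷ ks) ls =
  trans (cong (d k ⊙ φ^ k ⊕_) (digitValue-++ d ks ls))
        (sym (⊕-assoc (d k ⊙ φ^ k) (digitValue d ks) (digitValue d ls)))

range-negsuc : ∀ M K → range -[1+ M ] (+ K) ≡ -[1+ M ] ∷ range (ℤ.- (+ M)) (+ K)
range-negsuc M K = cong (-[1+ M ] ∷_) (begin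
  map h (applyUpTo suc (K + suc M))   ≡⟨ map-applyUpTo suc h (K + suc M) ⟩
  applyUpTo (h ∘ suc) (K + suc M)     ≡⟨ sym (map-upTo (h ∘ suc) (K + suc M)) ⟩
  map (h ∘ suc) (upTo (K + suc M))    ≡⟨ map-cong shift (upTo (K + suc M)) ⟩
  map h′ (upTo (K + suc M))           ≡⟨ cong (map h′ ∘ upTo) (trans (ℕ.+-suc K M) (cong suc (sym ∣K+M∣))) ⟩
  map h′ (upTo (suc ∣ + K ℤ.- ℤ.- (+ M) ∣)) ∎)
  where
  open ≡-Reasoning
  h h′ : ℕ → ℤ
  h  t = -[1+ M ] ℤ.+ + t
  h′ t = ℤ.- (+ M) ℤ.+ + t
  shift : ∀ t → h (suc t) ≡ h′ t
  shift t = trans (ℤ.[1+m]⊖[1+n]≡m⊖n t M) (sym (ℤ.-m+n≡n⊖m M t))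
  ∣K+M∣ : ∣ + K ℤ.- ℤ.- (+ M) ∣ ≡ K + M
  ∣K+M∣ = cong (λ i → ∣ + K ℤ.+ i ∣) (ℤ.neg-involutive (+ M))

range-0 : ∀ K → range (+ 0) (+ K) ≡ map +_ (upTo (suc K))
range-0 K = cong (map +_ ∘ upTo ∘ suc) (ℕ.+-identityʳ K)

digitValue-upTo : ∀ d K → digitValue d (map +_ (upTo (suc K))) ≡ ι (d (+ 0)) ⊕ intSum (d ∘ +_) K
digitValue-upTo d zero    = cong (_⊕ zeroφ) (sym (ι≡⊙ι1 (d (+ 0))))
digitValue-upTo d (suc K) = begin
  digitValue d (map +_ (upTo (suc (suc K))))
    ≡⟨ cong (λ ks → digitValue d (map +_ ks)) (sym (applyUpTo-∷ʳ (λ t → t) (suc K))) ⟩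
  digitValue d (map +_ (upTo (suc K) ++ suc K ∷ []))
    ≡⟨ cong (digitValue d) (map-++ +_ (upTo (suc K)) (suc K ∷ [])) ⟩
  digitValue d (map +_ (upTo (suc K)) ++ + suc K ∷ [])
    ≡⟨ digitValue-++ d (map +_ (upTo (suc K))) (+ suc K ∷ []) ⟩
  digitValue d (map +_ (upTo (suc K))) ⊕ (t ⊕ zeroφ)
    ≡⟨ cong₂ _⊕_ (digitValue-upTo d K) (⊕-identityʳ t) ⟩
  ι (d (+ 0)) ⊕ intSum (d ∘ +_) K ⊕ t
    ≡⟨ ⊕-assoc (ι (d (+ 0))) (intSum (d ∘ +_) K) t ⟩
  ι (d (+ 0)) ⊕ (intSum (d ∘ +_) K ⊕ t)
    ≡⟨ cong (ι (d (+ 0)) ⊕_) (⊕-comm (intSum (d ∘ +_) K) t) ⟩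
  ι (d (+ 0)) ⊕ intSum (d ∘ +_) (suc K) ∎
  where
  open ≡-Reasoning
  t : Zφ
  t = d (+ suc K) ⊙ φ^⁺ (suc K)

baseφValue-split : ∀ d M K →
  baseφValue d (ℤ.- (+ M)) (+ K) ≡ fracSum (d ∘ ℤ.-_ ∘ +_) M ⊕ (ι (d (+ 0)) ⊕ intSum (d ∘ +_) K)
baseφValue-split d zero    K =
  trans (cong (digitValue d) (range-0 K)) (trans (digitValue-upTo d K) (sym (⊕-identityˡ _)))
baseφValue-split d (suc M) K = begin
  baseφValue d -[1+ M ] (+ K)                    ≡⟨ cong (digitValue d) (range-negsuc M K) ⟩
  t ⊕ baseφValue d (ℤ.- (+ M)) (+ K)             ≡⟨ cong (t ⊕_) (baseφValue-split d M K) ⟩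
  t ⊕ (fracSum (d ∘ ℤ.-_ ∘ +_) M ⊕ nonnegPart)   ≡⟨ sym (⊕-assoc t (fracSum (d ∘ ℤ.-_ ∘ +_) M) nonnegPart) ⟩
  fracSum (d ∘ ℤ.-_ ∘ +_) (suc M) ⊕ nonnegPart   ∎
  where
  open ≡-Reasoning
  t nonnegPart : Zφ
  t = d -[1+ M ] ⊙ φ^⁻ (suc M)
  nonnegPart = ι (d (+ 0)) ⊕ intSum (d ∘ +_) K

ι-⊕-<φ-reflect : ∀ {m n} z → ι m ⊕ z <φ ι n ⊕ z → m < n
ι-⊕-<φ-reflect z = ι-<φ-reflect ∘ ⊕-cancelʳ-<φ z

<+1⇒≤ : ∀ {m n} → m < n + 1 → m ≤ n
<+1⇒≤ {m} {n} m<n+1 = ℕ.m<1+n⇒m≤n (subst (m <_) (ℕ.+-comm n 1) m<n+1)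

module _ {N X : ℕ} {a e o : Zφ} (eq : ι N ⊕ e ≡ ι X ⊕ (a ⊕ o))
         (a≥0 : Nonneg a) (e≥0 : Nonneg e) (o≥0 : Nonneg o)
         (a<1 : a <φ ι 1) (e<1 : e <φ ι 1) (o<1 : o <φ ι 1) where

  carry : e <φ o → N ≡ X + 1
  carry e<o = ℕ.≤-antisym N≤X+1 X+1≤N
    where
    X+1≤N : X + 1 ≤ N
    X+1≤N = subst (_≤ N) (ℕ.+-comm 1 X) (ι-⊕-<φ-reflect e
              (subst (ι X ⊕ e <φ_) (sym eq) (⊕-monoʳ-<φ (ι X) (<φ-≤φ-trans e<o (≤φ-⊕ˡ o a≥0)))))
    N≤X+1 : N ≤ X + 1
    N≤X+1 = ℕ.m<1+n⇒m≤n (subst (N <_) (ℕ.+-suc X 1) (ι-⊕-<φ-reflect e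
              (subst (_<φ ι (X + 2) ⊕ e) (sym eq)
                (<φ-≤φ-trans (⊕-monoʳ-<φ (ι X) (⊕-mono-<φ-≤φ a<1 (<⇒≤φ o<1))) (≤φ-⊕ʳ (ι X ⊕ ι 2) e≥0)))))

  no-carry : o ≤φ e → N ≡ X
  no-carry o≤e = ℕ.≤-antisym (<+1⇒≤ N<X+1) (<+1⇒≤ X<N+1)
    where
    N<X+1 : N < X + 1
    N<X+1 = ι-⊕-<φ-reflect e
      (subst₂ _<φ_ (sym eq) (sym (⊕-assoc (ι X) (ι 1) e)) (⊕-monoʳ-<φ (ι X) (⊕-mono-<φ-≤φ a<1 o≤e)))
    X<N+1 : X < N + 1
    X<N+1 = ι-<φ-reflect
      (≤φ-<φ-trans (≤φ-⊕ʳ (ι X) (nonneg-⊕ a≥0 o≥0)) (subst (_<φ ι (N + 1)) eq (⊕-monoʳ-<φ (ι N) e<1)))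

%2≡1⇒parity≡1ℙ : ∀ n → n % 2 ≡ 1 → parity n ≡ 1ℙ
%2≡1⇒parity≡1ℙ (suc zero)    _ = refl
%2≡1⇒parity≡1ℙ (suc (suc n)) h = %2≡1⇒parity≡1ℙ n h

%2≡0⇒parity≡0ℙ : ∀ n → n % 2 ≡ 0 → parity n ≡ 0ℙ
%2≡0⇒parity≡0ℙ zero          _ = refl
%2≡0⇒parity≡0ℙ (suc (suc n)) h = %2≡0⇒parity≡0ℙ n h

-- Both sides are compared with φ⁻ⁱ: the right one contains the digit at i, the left one vanishes up to i.
restrict-leading : ∀ p {g i m} → (∀ k → g k ≤ 1) → (∀ k → 0 < k → k < i → g k ≡ 0) → g i ≡ 1 →
  0 < i → i ≤ m → parity i ≡ p → fracSum (restrict (p ⁻¹) g) m <φ fracSum (restrict p g) m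
restrict-leading p {g} {i} g≤1 g<i≡0 gi≡1 0<i i≤m e = <φ-≤φ-trans
  (fracSum-<φ (λ k → ℕ.≤-trans (restrict-≤ (p ⁻¹) g k) (g≤1 k)) (restrict-nonadjacent (p ⁻¹) g) vanish i≤m)
  (φ^⁻-≤φ-fracSum (restrict p g) (trans (restrict-self p g i e) gi≡1) 0<i i≤m)
  where
  vanish : ∀ k → 1 ≤ k → k ≤ i → restrict (p ⁻¹) g k ≡ 0
  vanish k 1≤k k≤i with ℕ.m≤n⇒m<n∨m≡n k≤i
  ... | inj₁ k<i = restrict-vanish (p ⁻¹) g (g<i≡0 k 1≤k k<i)
  ... | inj₂ refl = restrict-other (p ⁻¹) g i (trans e (sym (⁻¹-involutive p)))

negsuc+1 : ∀ m → -[1+ m ] ℤ.+ + 1 ≡ ℤ.- (+ m)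
negsuc+1 zero    = refl
negsuc+1 (suc m) = refl

lucas-representation : ∀ {N} M K d → (∀ k → d k ≤ 1) → (∀ k → + K ℤ.< k → d k ≡ 0) →
  (∀ k → d k * d (k ℤ.+ + 1) ≡ 0) → ι N ≡ baseφValue d (ℤ.- (+ M)) (+ K) →
  (i : ℕ) → 0 < i → d (+ i) ≡ 1 → (∀ j → 0 < j → j < i → d (+ j) ≡ 0) →
  (i % 2 ≡ 1 → N ≡ lucasSum d K + d (+ 0) + 1) × (i % 2 ≡ 0 → N ≡ lucasSum d K + d (+ 0))
lucas-representation {N} M K d d≤1 d>K≡0 d-nonadjacent value i 0<i di≡1 d<i≡0 =
  (λ odd  → carry    key A≥0 E≥0 O≥0 A<1 E<1 O<1 (leading 1ℙ (%2≡1⇒parity≡1ℙ i odd))) ,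
  (λ even → no-carry key A≥0 E≥0 O≥0 A<1 E<1 O<1 (<⇒≤φ (leading 0ℙ (%2≡0⇒parity≡0ℙ i even))))
  where
  open ≡-Reasoning
  g : ℕ → ℕ
  g = d ∘ +_
  A E O P : Zφ
  A = fracSum (d ∘ ℤ.-_ ∘ +_) M
  E = fracSum (restrict 0ℙ g) K
  O = fracSum (restrict 1ℙ g) K
  P = intSum g K

  key : ι N ⊕ E ≡ ι (lucasSum d K + d (+ 0)) ⊕ (A ⊕ O)
  key = begin
    ι N ⊕ E                           ≡⟨ cong (_⊕ E) (trans value (baseφValue-split d M K)) ⟩
    A ⊕ (ι (d (+ 0)) ⊕ P) ⊕ E         ≡⟨ solve 4 (λ A z P E → A ⊞ (z ⊞ P) ⊞ E ⊜ z ⊞ A ⊞ (P ⊞ E)) refl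
                                           A (ι (d (+ 0))) P E ⟩
    ι (d (+ 0)) ⊕ A ⊕ (P ⊕ E)         ≡⟨ cong (ι (d (+ 0)) ⊕ A ⊕_) (intSum-lucas d K) ⟩
    ι (d (+ 0)) ⊕ A ⊕ (ι (lucasSum d K) ⊕ O)
                                      ≡⟨ solve 4 (λ z A S O → z ⊞ A ⊞ (S ⊞ O) ⊜ S ⊞ z ⊞ (A ⊞ O)) refl
                                           (ι (d (+ 0))) A (ι (lucasSum d K)) O ⟩
    ι (lucasSum d K + d (+ 0)) ⊕ (A ⊕ O) ∎

  g≤1 : ∀ k → g k ≤ 1
  g≤1 k = d≤1 (+ k)

  restrict-≤1 : ∀ p k → restrict p g k ≤ 1
  restrict-≤1 p k = ℕ.≤-trans (restrict-≤ p g k) (g≤1 k)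

  behind-nonadjacent : ∀ m → d (ℤ.- (+ m)) * d -[1+ m ] ≡ 0
  behind-nonadjacent m =
    trans (ℕ.*-comm (d (ℤ.- (+ m))) (d -[1+ m ]))
          (subst (λ k → d -[1+ m ] * d k ≡ 0) (negsuc+1 m) (d-nonadjacent -[1+ m ]))

  A≥0 : Nonneg A
  A≥0 = fracSum-nonneg (d ∘ ℤ.-_ ∘ +_) M
  E≥0 : Nonneg E
  E≥0 = fracSum-nonneg (restrict 0ℙ g) K
  O≥0 : Nonneg O
  O≥0 = fracSum-nonneg (restrict 1ℙ g) K
  A<1 : A <φ ι 1
  A<1 = fracSum-<φ-1 (λ m → d≤1 (ℤ.- (+ m))) behind-nonadjacent M
  E<1 : E <φ ι 1
  E<1 = fracSum-<φ-1 (restrict-≤1 0ℙ) (restrict-nonadjacent 0ℙ g) K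
  O<1 : O <φ ι 1
  O<1 = fracSum-<φ-1 (restrict-≤1 1ℙ) (restrict-nonadjacent 1ℙ g) K

  i≤K : i ≤ K
  i≤K = ℕ.≮⇒≥ (λ K<i → ℕ.1+n≢0 (trans (sym di≡1) (d>K≡0 (+ i) (ℤ.+<+ K<i))))

  leading : ∀ p → parity i ≡ p → fracSum (restrict (p ⁻¹) g) K <φ fracSum (restrict p g) K
  leading p = restrict-leading p g≤1 d<i≡0 di≡1 0<i i≤K

theorem1 : (N : ℕ) → 0 < N →
    (R L : ℤ) → R ℤ.≤ + 0 → + 0 ℤ.≤ L →
    (d : ℤ → ℕ) →
    (∀ k → d k ≤ 1) →
    (∀ k → k ℤ.< R → d k ≡ 0) →
    (∀ k → L ℤ.< k → d k ≡ 0) →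
    (∀ k → d k * d (k ℤ.+ + 1) ≡ 0) →
    ι N ≡ baseφValue d R L →
    (i : ℕ) → 0 < i → d (+ i) ≡ 1 →
    (∀ j → 0 < j → j < i → d (+ j) ≡ 0) →
    (i % 2 ≡ 1 → N ≡ lucasSum d ∣ L ∣ + d (+ 0) + 1)
    × (i % 2 ≡ 0 → N ≡ lucasSum d ∣ L ∣ + d (+ 0))
theorem1 N _ (+ suc _)  _      (ℤ.+≤+ ()) _
theorem1 N _ _          -[1+ _ ] _        ()
theorem1 N _ (+ zero)   (+ K)  _ _ d d≤1 _ = lucas-representation 0 K d d≤1
theorem1 N _ -[1+ M ]   (+ K)  _ _ d d≤1 _ = lucas-representation (suc M) K d d≤1
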